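{- Let $G$ be a graph, $k,\ell\ge1$, $S$ an independent set of size $k$, and $J_0=S,J_1,\dots,J_\ell$ independent sets of $G$. Define collections (lists) $\mathcal{C}_0,\dots,\mathcal{C}_\ell$ of constraint sets: $\mathcal{C}_0=\{\{(S,k)\}\}$, and for $i\in\{1,\dots,\ell\}$, $\mathcal{C}_i$ contains, for every $C\in\mathcal{C}_{i-1}$ and every $(X,b)\in C$, one constraint set $C'$ consisting of: $(N(X)\cap J_i,1)$; $(X\cap J_i,b-1)$ if $b\ge2$ (nothing if $b=1$); and $(X'\cap J_i,b')$ for every other $(X',b')\in C$. Then for every $i\in\{0,\dots,\ell\}$, the total number of constraints $c_i=\sum_{C\in\mathcal{C}_i}|C|$ satisfies $c_i\le (i+1)!$; in particular $c_\ell\le(\ell+1)!$.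
   Context: A constraint is a pair $(X,b)$ with $X\subseteq V(G)$ and $b$ a positive integer. For $X\subseteq V(G)$, $N(X)$ denotes the set of vertices not in $X$ adjacent to some vertex of $X$. A set is independent if its vertices are pairwise non-adjacent. -}

module Defs where

open import Data.Nat using (ℕ; zero; suc; _≤?_; _∸_)
open import Data.Bool using (Bool; true; false; not; _∧_; if_then_else_)
open import Data.Fin using (Fin)
open import Data.Fin.Subset using (Subset; _∈_; _∩_)
open import Data.Vec using (tabulate; lookup)
open import Data.Product using (_×_; _,_)
open import Data.List using (List; []; _∷_; _++_; [_]; map; concatMap; length; allFin)
open import Data.Bool.ListAction using (any)
open import Data.Nat.ListAction using (sum)
open import Relation.Nullary.Decidable using (does)
open import Relation.Binary.PropositionalEquality using (_≡_)

record Graph (n : ℕ) : Set where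
  field
    adj    : Fin n → Fin n → Bool
    sym    : ∀ u v → adj u v ≡ adj v u
    irrefl : ∀ v → adj v v ≡ false
open Graph public

module _ {n : ℕ} (G : Graph n) where

  Independent : Subset n → Set
  Independent X = ∀ u v → u ∈ X → v ∈ X → adj G u v ≡ false

  N : Subset n → Subset n
  N X = tabulate λ v → not (lookup X v) ∧ any (λ u → lookup X u ∧ adj G u v) (allFin n)

  Constraint : Set
  Constraint = Subset n × ℕ

  ConstraintSet : Set
  ConstraintSet = List Constraint

  restrict : Subset n → Constraint → Constraint
  restrict J (X' , b') = (X' ∩ J , b')

  newConstraints : Subset n → Constraint → List Constraint
  newConstraints J (X , b) =
    (N X ∩ J , 1) ∷ (if does (2 ≤? b) then [ (X ∩ J , b ∸ 1) ] else [])

  -- for every (X,b) ∈ C (by position), one constraint set C';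
  -- `pre` holds the constraints of C before the current one.
  branchGo : Subset n → List Constraint → List Constraint → List ConstraintSet
  branchGo J pre [] = []
  branchGo J pre (c ∷ post) =
    (newConstraints J c ++ map (restrict J) (pre ++ post)) ∷ branchGo J (pre ++ [ c ]) post

  branch : Subset n → ConstraintSet → List ConstraintSet
  branch J C = branchGo J [] C

  𝒞 : (J : ℕ → Subset n) (S : Subset n) (k : ℕ) → ℕ → List ConstraintSet
  𝒞 J S k zero    = [ (S , k) ] ∷ []
  𝒞 J S k (suc i) = concatMap (branch (J (suc i))) (𝒞 J S k i)

  totalConstraints : (J : ℕ → Subset n) (S : Subset n) (k : ℕ) → ℕ → ℕ
  totalConstraints J S k i = sum (map length (𝒞 J S k i))

-- Branching on a constraint (X , b) of a set C produces a set with at most two constraints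
-- in place of (X , b) and the other |C| - 1 constraints restricted, so every constraint set of
-- 𝒞_i has at most i + 1 constraints. Each set C of 𝒞_i spawns exactly |C| sets of 𝒞_{i+1},
-- so 𝒞_{i+1} has c_i members, each of size at most i + 2, whence c_{i+1} ≤ (i + 2) c_i.
module Submission where

open import Defs
open import Data.Nat using (ℕ; zero; suc; _+_; _*_; _≤_; z≤n; s≤s; _≤?_; _!)
open import Data.Nat.Properties
  using (≤-refl; +-assoc; +-suc; +-mono-≤; +-monoˡ-≤; *-monoˡ-≤; *-comm; module ≤-Reasoning)
open import Data.Nat.ListAction using (sum)
open import Data.Bool using (true; false)
open import Data.List using (List; []; _∷_; _++_; [_]; map; concat; concatMap; length)
open import Data.List.Properties using (length-++; length-map; map-∘; map-cong)
open import Data.List.Relation.Unary.All using (All; []; _∷_)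
open import Data.List.Relation.Unary.All.Properties using (map⁺; concat⁺)
import Data.List.Relation.Unary.All as All
open import Data.Fin.Subset using (Subset; ∣_∣)
open import Data.Product using (_,_)
open import Function using (_∘_)
open import Relation.Nullary.Decidable using (does)
open import Relation.Binary.PropositionalEquality using (_≡_; refl; cong; cong₂; module ≡-Reasoning)

length-concat : ∀ {a} {A : Set a} (xss : List (List A)) → length (concat xss) ≡ sum (map length xss)
length-concat []         = refl
length-concat (xs ∷ xss) = begin
  length (xs ++ concat xss)          ≡⟨ length-++ xs ⟩
  length xs + length (concat xss)    ≡⟨ cong (length xs +_) (length-concat xss) ⟩
  length xs + sum (map length xss)   ∎
  where open ≡-Reasoning

sum≤length* : ∀ {b} {ns : List ℕ} → All (_≤ b) ns → sum ns ≤ length ns * b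
sum≤length* []         = z≤n
sum≤length* (n≤b ∷ ps) = +-mono-≤ n≤b (sum≤length* ps)

module _ {n : ℕ} (G : Graph n) where

  length-newConstraints≤2 : ∀ J c → length (newConstraints G J c) ≤ 2
  length-newConstraints≤2 J (X , b) with does (2 ≤? b)
  ... | true  = ≤-refl
  ... | false = s≤s z≤n

  length-branchGo : ∀ J (pre post : ConstraintSet G) → length (branchGo G J pre post) ≡ length post
  length-branchGo J pre []         = refl
  length-branchGo J pre (c ∷ post) = cong suc (length-branchGo J (pre ++ [ c ]) post)

  branchGo-length≤ : ∀ J m (pre post : ConstraintSet G) → length pre + length post ≤ m →
    All (λ C → length C ≤ suc m) (branchGo G J pre post)
  branchGo-length≤ J m pre []         _ = []
  branchGo-length≤ J m pre (c ∷ post) h = head≤ ∷ branchGo-length≤ J m (pre ++ [ c ]) post shifted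
    where
    open ≤-Reasoning
    head≤ : length (newConstraints G J c ++ map (restrict G J) (pre ++ post)) ≤ suc m
    head≤ = begin
      length (newConstraints G J c ++ map (restrict G J) (pre ++ post))
        ≡⟨ length-++ (newConstraints G J c) ⟩
      length (newConstraints G J c) + length (map (restrict G J) (pre ++ post))
        ≡⟨ cong₂ _+_ refl (length-map (restrict G J) (pre ++ post)) ⟩
      length (newConstraints G J c) + length (pre ++ post)
        ≤⟨ +-monoˡ-≤ _ (length-newConstraints≤2 J c) ⟩
      2 + length (pre ++ post)
        ≡⟨ cong (2 +_) (length-++ pre) ⟩
      suc (suc (length pre + length post))
        ≡⟨ cong suc (+-suc (length pre) (length post)) ⟨
      suc (length pre + length (c ∷ post))
        ≤⟨ s≤s h ⟩
      suc m ∎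
    shifted : length (pre ++ [ c ]) + length post ≤ m
    shifted = begin
      length (pre ++ [ c ]) + length post ≡⟨ cong (_+ length post) (length-++ pre) ⟩
      length pre + 1 + length post        ≡⟨ +-assoc (length pre) 1 (length post) ⟩
      length pre + length (c ∷ post)      ≤⟨ h ⟩
      m ∎

  length-concatMap-branch : ∀ J (𝓛 : List (ConstraintSet G)) →
    length (concatMap (branch G J) 𝓛) ≡ sum (map length 𝓛)
  length-concatMap-branch J 𝓛 = begin
    length (concat (map (branch G J) 𝓛))      ≡⟨ length-concat (map (branch G J) 𝓛) ⟩
    sum (map length (map (branch G J) 𝓛))     ≡⟨ cong sum (map-∘ 𝓛) ⟨
    sum (map (length ∘ branch G J) 𝓛)         ≡⟨ cong sum (map-cong (length-branchGo J []) 𝓛) ⟩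
    sum (map length 𝓛)                        ∎
    where open ≡-Reasoning

  module _ (J : ℕ → Subset n) (S : Subset n) (k : ℕ) where

    𝒞-length≤ : ∀ i → All (λ C → length C ≤ suc i) (𝒞 G J S k i)
    𝒞-length≤ zero    = s≤s z≤n ∷ []
    𝒞-length≤ (suc i) =
      concat⁺ (map⁺ (All.map (λ {C} → branchGo-length≤ (J (suc i)) (suc i) [] C) (𝒞-length≤ i)))

    totalConstraints-suc≤ : ∀ i → totalConstraints G J S k (suc i) ≤ totalConstraints G J S k i * (2 + i)
    totalConstraints-suc≤ i = begin
      sum (map length (𝒞 G J S k (suc i)))         ≤⟨ sum≤length* (map⁺ (𝒞-length≤ (suc i))) ⟩
      length (map length (𝒞 G J S k (suc i))) * (2 + i)
        ≡⟨ cong (_* (2 + i)) (length-map length (𝒞 G J S k (suc i))) ⟩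
      length (𝒞 G J S k (suc i)) * (2 + i)
        ≡⟨ cong (_* (2 + i)) (length-concatMap-branch (J (suc i)) (𝒞 G J S k i)) ⟩
      totalConstraints G J S k i * (2 + i)         ∎
      where open ≤-Reasoning

    totalConstraints≤ : ∀ i → totalConstraints G J S k i ≤ (suc i) !
    totalConstraints≤ zero    = s≤s z≤n
    totalConstraints≤ (suc i) = begin
      totalConstraints G J S k (suc i)   ≤⟨ totalConstraints-suc≤ i ⟩
      totalConstraints G J S k i * (2 + i) ≤⟨ *-monoˡ-≤ (2 + i) (totalConstraints≤ i) ⟩
      (suc i) ! * (2 + i)                ≡⟨ *-comm ((suc i) !) (2 + i) ⟩
      (2 + i) !                          ∎
      where open ≤-Reasoning

lemma3p4 : ∀ {n} (G : Graph n) (k ℓ : ℕ) → 1 ≤ k → 1 ≤ ℓ →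
    (S : Subset n) → Independent G S → ∣ S ∣ ≡ k →
    (J : ℕ → Subset n) → J 0 ≡ S → (∀ i → i ≤ ℓ → Independent G (J i)) →
    ∀ i → i ≤ ℓ → totalConstraints G J S k i ≤ (suc i) !
lemma3p4 G k ℓ _ _ S _ _ J _ _ i _ = totalConstraints≤ G J S k i
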